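{- Let $\ell \geq 4$ be an even integer. If $n > 12\ell^2 + 36\ell + 24$, then there is a symmetric complete $(\ell,1)$-sum-free set $S \subseteq \mathbb{Z}_n$.
   Context: For a subset $S$ of an abelian group $\Gamma$ (written additively) and a positive integer $\ell$, the $\ell$-fold sumset is $\ell S = \{ s_1 + s_2 + \dots + s_\ell : s_i \in S\}$. The set $S$ is $(\ell,1)$-sum-free if $(\ell S) \cap S = \emptyset$; such a set is complete if moreover $\ell S \cup S = \Gamma$ (so $\ell S$ and $S$ partition $\Gamma$). $S$ is symmetric if $s \in S$ implies $-s \in S$. $\mathbb{Z}_n$ denotes the cyclic group of integers modulo $n$. -}

module Defs where

open import Data.Nat using (ℕ; zero; suc; _+_; _∸_; NonZero)
open import Data.Nat.DivMod using (_mod_)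
open import Data.Fin using (Fin; toℕ)
open import Data.Vec using (Vec; foldr)
open import Data.Vec.Relation.Unary.All using (All)
open import Data.Product using (∃; _×_)
open import Data.Empty using (⊥)
open import Data.Sum using (_⊎_)
open import Relation.Binary.PropositionalEquality using (_≡_)

ℤ_ : ℕ → Set
ℤ n = Fin n

_⊕_ : ∀ {n} .{{_ : NonZero n}} → ℤ n → ℤ n → ℤ n
_⊕_ {n} a b = (toℕ a + toℕ b) mod n

⊖_ : ∀ {n} .{{_ : NonZero n}} → ℤ n → ℤ n
⊖_ {n} a = (n ∸ toℕ a) mod n

𝟘 : ∀ {n} .{{_ : NonZero n}} → ℤ n
𝟘 {n} = 0 mod n

SubsetOf : ℕ → Set₁
SubsetOf n = ℤ n → Set

sumℤ : ∀ {n} .{{_ : NonZero n}} {k} → Vec (ℤ n) k → ℤ n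
sumℤ = foldr _ _⊕_ 𝟘

sumset : ∀ {n} .{{_ : NonZero n}} → ℕ → SubsetOf n → SubsetOf n
sumset ℓ S x = ∃ λ (v : Vec _ ℓ) → All S v × sumℤ v ≡ x

SumFree : ∀ {n} .{{_ : NonZero n}} → ℕ → SubsetOf n → Set
SumFree ℓ S = ∀ x → sumset ℓ S x → S x → ⊥

CompleteSumFree : ∀ {n} .{{_ : NonZero n}} → ℕ → SubsetOf n → Set
CompleteSumFree ℓ S = SumFree ℓ S × (∀ x → (sumset ℓ S x ⊎ S x))

Symmetric : ∀ {n} .{{_ : NonZero n}} → SubsetOf n → Set
Symmetric S = ∀ s → S s → S (⊖ s)

module Submission where

-- For even ℓ take S = [a, a + d] ∪ [−(a + d), −a] ⊆ ℤ_n, which is symmetric. With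
-- u = −(a + d), an ℓ-fold sum with j summands from the first interval and k from the
-- second is j·a + k·u + W with 0 ≤ W ≤ ℓd. For ℓ = 4K or 4K + 2 the parameters a,
-- d = e + f and u are linear in e, f and chosen so that 4a = n − (2e + f), resp.
-- 4a = n − (2e + 3f). Then, according to the sign of j − k and to j − k mod 4, every such
-- sum lies within a − 1 of a multiple of n or strictly between the two intervals, so
-- ℓS ∩ S = ∅; conversely every residue outside S is such a sum. These n are exactly
-- 4 + (2ℓ + 2)e + (3ℓ + 1)f, and since gcd(2ℓ + 2, ℓ − 1) = 1 every n > 12ℓ² + 36ℓ + 24
-- has this form with e, f ≥ 0.

open import Defs
open import Data.Nat using (ℕ; zero; suc; _+_; _*_; _∸_; _<_; _≤_; z≤n; s≤s; _≤?_; _<?_; NonZero)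
open import Data.Nat.Properties
open import Data.Nat.DivMod
  using (_%_; _/_; %-distribˡ-+; m%n%n≡m%n; [m+kn]%n≡m%n; m<n⇒m%n≡m; m%n<n; m≡m%n+[m/n]*n)
open import Data.Nat.Divisibility using (_∣_; divides-refl)
open import Data.Nat.Tactic.RingSolver using (solve-∀)
open import Data.Fin using (toℕ; fromℕ<)
open import Data.Fin.Properties using (toℕ-injective; toℕ<n; toℕ-fromℕ<)
open import Data.Vec using (Vec; []; _∷_; map; sum)
open import Data.Vec.Relation.Unary.All using (All; []; _∷_)
open import Data.Product using (∃; ∃₂; _×_; _,_)
open import Data.Sum using (_⊎_; inj₁; inj₂)
open import Relation.Nullary using (¬_; yes; no; contradiction)
open import Relation.Binary.PropositionalEquality

[kn+m]%n≡m : ∀ k {m n} .{{_ : NonZero n}} → m < n → (k * n + m) % n ≡ m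
[kn+m]%n≡m k {m} {n} m<n = begin
  (k * n + m) % n  ≡⟨ cong (_% n) (+-comm (k * n) m) ⟩
  (m + k * n) % n  ≡⟨ [m+kn]%n≡m%n m k n ⟩
  m % n            ≡⟨ m<n⇒m%n≡m m<n ⟩
  m                ∎
  where open ≡-Reasoning

[m+n%o]%o≡[m+n]%o : ∀ m n o .{{_ : NonZero o}} → (m + n % o) % o ≡ (m + n) % o
[m+n%o]%o≡[m+n]%o m n o = begin
  (m + n % o) % o          ≡⟨ %-distribˡ-+ m (n % o) o ⟩
  (m % o + n % o % o) % o  ≡⟨ cong (λ x → (m % o + x) % o) (m%n%n≡m%n n o) ⟩
  (m % o + n % o) % o      ≡⟨ %-distribˡ-+ m n o ⟨
  (m + n) % o              ∎
  where open ≡-Reasoning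

m+n≡o⇒m≤o : ∀ m {n o} → m + n ≡ o → m ≤ o
m+n≡o⇒m≤o m {n} refl = m≤m+n m n

m<1+m+n+o : ∀ m n o → m < suc m + n + o
m<1+m+n+o m n o = s≤s (≤-trans (m≤m+n m n) (m≤m+n (m + n) o))

+-monoʳ-≤-within : ∀ m {n o p q} → n ≤ o → m + o + p ≡ q → m + n ≤ q
+-monoʳ-≤-within m {o = o} {p} n≤o refl = ≤-trans (+-monoʳ-≤ m n≤o) (m≤m+n (m + o) p)

≤-suc-*-split : ∀ m d W → W ≤ suc m * d → ∃₂ λ w W′ → w ≤ d × W′ ≤ m * d × W ≡ w + W′
≤-suc-*-split m d W W≤ with W ≤? d
... | yes W≤d = W , 0 , W≤d , z≤n , sym (+-identityʳ W)
... | no  W≰d = d , W ∸ d , ≤-refl , W∸d≤ , sym (m+[n∸m]≡n (<⇒≤ (≰⇒> W≰d)))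
  where
  W∸d≤ : W ∸ d ≤ m * d
  W∸d≤ = subst (W ∸ d ≤_) (m+n∸m≡n d (m * d)) (∸-monoˡ-≤ d W≤)

-- f ≡ N·α⁻¹ (mod M), so M divides N − αf.
α*M≤N⇒N≡M*d+α*f : ∀ M α {inv c} N .{{_ : NonZero M}} → α * inv ≡ 1 + M * c → α * M ≤ N →
  ∃₂ λ d f → f < M × N ≡ M * d + α * f
α*M≤N⇒N≡M*d+α*f M α {inv} {c} N α*inv≡ α*M≤N = α * q ∸ N * c , f , f<M , N≡
  where
  f q r : ℕ
  f = (N * inv) % M
  q = (N * inv) / M
  r = N ∸ α * f
  f<M : f < M
  f<M = m%n<n (N * inv) M
  αf≤N : α * f ≤ N
  αf≤N = ≤-trans (*-monoʳ-≤ α (<⇒≤ f<M)) α*M≤N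

  two-ways : r + M * (N * c) + α * f ≡ M * (α * q) + α * f
  two-ways = begin
    r + M * (N * c) + α * f  ≡⟨ +-comm-middle r (M * (N * c)) (α * f) ⟩
    r + α * f + M * (N * c)  ≡⟨ cong (_+ M * (N * c)) (m∸n+n≡m αf≤N) ⟩
    N + M * (N * c)          ≡⟨ distribute N M c ⟩
    N * (1 + M * c)          ≡⟨ cong (N *_) α*inv≡ ⟨
    N * (α * inv)            ≡⟨ swap N α inv ⟩
    α * (N * inv)            ≡⟨ cong (α *_) (m≡m%n+[m/n]*n (N * inv) M) ⟩
    α * (f + q * M)          ≡⟨ expand α f q M ⟩
    M * (α * q) + α * f      ∎
    where
    open ≡-Reasoning
    +-comm-middle : ∀ x y z → x + y + z ≡ x + z + y
    +-comm-middle = solve-∀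
    distribute : ∀ N M c → N + M * (N * c) ≡ N * (1 + M * c)
    distribute = solve-∀
    swap : ∀ N α inv → N * (α * inv) ≡ α * (N * inv)
    swap = solve-∀
    expand : ∀ α f q M → α * (f + q * M) ≡ M * (α * q) + α * f
    expand = solve-∀

  M*d≡r : M * (α * q ∸ N * c) ≡ r
  M*d≡r = begin
    M * (α * q ∸ N * c)        ≡⟨ *-distribˡ-∸ M (α * q) (N * c) ⟩
    M * (α * q) ∸ M * (N * c)  ≡⟨ cong (_∸ M * (N * c)) (+-cancelʳ-≡ (α * f) _ _ two-ways) ⟨
    r + M * (N * c) ∸ M * (N * c) ≡⟨ m+n∸n≡m r (M * (N * c)) ⟩
    r                          ∎
    where open ≡-Reasoning

  N≡ : N ≡ M * (α * q ∸ N * c) + α * f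
  N≡ = trans (sym (m∸n+n≡m αf≤N)) (cong (_+ α * f) (sym M*d≡r))

[M+α]*M<N⇒N≡M*e+[M+α]*f : ∀ M α {inv c} N .{{_ : NonZero M}} → α * inv ≡ 1 + M * c → (M + α) * M < N →
  ∃₂ λ e f → N ≡ M * e + (M + α) * f
[M+α]*M<N⇒N≡M*e+[M+α]*f M α N α*inv≡ bound
  with d , f , f<M , N≡ ← α*M≤N⇒N≡M*d+α*f M α N α*inv≡ (≤-trans (*-monoˡ-≤ M (m≤n+m α M)) (<⇒≤ bound))
  with f ≤? d
... | yes f≤d with e , refl ← m≤n⇒∃[o]m+o≡n f≤d = e , f , trans N≡ (regroup M α e f)
  where
  regroup : ∀ M α e f → M * (f + e) + α * f ≡ M * e + (M + α) * f
  regroup = solve-∀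
... | no f≰d = contradiction bound (≤⇒≯ N≤)
  where
  open ≤-Reasoning
  N≤ : N ≤ (M + α) * M
  N≤ = begin
    N                  ≡⟨ N≡ ⟩
    M * d + α * f      ≤⟨ +-monoˡ-≤ (α * f) (*-monoʳ-≤ M (<⇒≤ (≰⇒> f≰d))) ⟩
    M * f + α * f      ≡⟨ *-distribʳ-+ f M α ⟨
    (M + α) * f        ≤⟨ *-monoʳ-≤ (M + α) (<⇒≤ f<M) ⟩
    (M + α) * M        ∎

a+[M+α]*M<n⇒n≡a+M*e+[M+α]*f : ∀ M α {inv c} a n .{{_ : NonZero M}} → α * inv ≡ 1 + M * c →
  a + (M + α) * M < n → ∃₂ λ e f → n ≡ a + (M * e + (M + α) * f)
a+[M+α]*M<n⇒n≡a+M*e+[M+α]*f M α a n α*inv≡ bound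
  with N , refl ← m≤n⇒∃[o]m+o≡n (m+n≤o⇒m≤o a (<⇒≤ bound))
  with e , f , N≡ ← [M+α]*M<N⇒N≡M*e+[M+α]*f M α N α*inv≡ (+-cancelˡ-< a _ N bound) =
  e , f , cong (a +_) N≡

-- Two symmetric intervals in ℤ_n

-- S = [a, a + d] ∪ [u, u + d] with a = b + 1 and n = a + d + u, so that u = −(a + d).
module TwoIntervals (b d u : ℕ) where

  n : ℕ
  n = suc b + d + u

  InS : ℕ → Set
  InS x = (suc b ≤ x × x ≤ suc b + d) ⊎ (u ≤ x × x ≤ u + d)

  S : SubsetOf n
  S x = InS (toℕ x)

  -- X is, modulo n, a sum of j elements a + wᵢ and k elements u + wᵢ of S, with W = Σ wᵢ.
  SumRep : ℕ → ℕ → Set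
  SumRep ℓ X = ∃₂ λ j k → ∃₂ λ W Q →
    j + k ≡ ℓ × W ≤ ℓ * d × j * suc b + k * u + W ≡ Q * n + X

  toℕ-sumℤ : ∀ {m} (v : Vec (ℤ n) m) → toℕ (sumℤ v) ≡ sum (map toℕ v) % n
  toℕ-sumℤ []      = toℕ-fromℕ< (m%n<n 0 n)
  toℕ-sumℤ (x ∷ v) = begin
    toℕ (x ⊕ sumℤ v)                        ≡⟨ toℕ-fromℕ< _ ⟩
    (toℕ x + toℕ (sumℤ v)) % n              ≡⟨ cong (λ y → (toℕ x + y) % n) (toℕ-sumℤ v) ⟩
    (toℕ x + sum (map toℕ v) % n) % n       ≡⟨ [m+n%o]%o≡[m+n]%o (toℕ x) (sum (map toℕ v)) n ⟩
    (toℕ x + sum (map toℕ v)) % n           ∎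
    where open ≡-Reasoning

  sum-of-members : ∀ {m} (v : Vec (ℤ n) m) → All S v → ∃₂ λ j k → ∃ λ W →
    j + k ≡ m × W ≤ m * d × sum (map toℕ v) ≡ j * suc b + k * u + W
  sum-of-members [] [] = 0 , 0 , 0 , refl , z≤n , refl
  sum-of-members (x ∷ v) (_ ∷ v⊆S) with sum-of-members v v⊆S
  sum-of-members (x ∷ v) (inj₁ (lo , hi) ∷ _) | j , k , W , refl , W≤ , Σv≡
    with w , x≡ ← m≤n⇒∃[o]m+o≡n lo =
    suc j , k , w + W , refl , +-mono-≤ (+-cancelˡ-≤ (suc b) w d (subst (_≤ _) (sym x≡) hi)) W≤ ,
    trans (cong₂ _+_ (sym x≡) Σv≡) (shuffle (suc b) w j k u W)
    where
    shuffle : ∀ a w j k u W → a + w + (j * a + k * u + W) ≡ suc j * a + k * u + (w + W)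
    shuffle = solve-∀
  sum-of-members (x ∷ v) (inj₂ (lo , hi) ∷ _) | j , k , W , refl , W≤ , Σv≡
    with w , x≡ ← m≤n⇒∃[o]m+o≡n lo =
    j , suc k , w + W , +-suc j k , +-mono-≤ (+-cancelˡ-≤ u w d (subst (_≤ _) (sym x≡) hi)) W≤ ,
    trans (cong₂ _+_ (sym x≡) Σv≡) (shuffle (suc b) w j k u W)
    where
    shuffle : ∀ a w j k u W → u + w + (j * a + k * u + W) ≡ j * a + suc k * u + (w + W)
    shuffle = solve-∀

  InS⇒InS-n∸ : ∀ {x} → InS x → InS (n ∸ x)
  InS⇒InS-n∸ {x} (inj₁ (lo , hi)) =
    inj₂ (subst (_≤ n ∸ x) n∸[b+1+d]≡u (∸-monoʳ-≤ n hi) , subst (n ∸ x ≤_) n∸[b+1]≡u+d (∸-monoʳ-≤ n lo))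
    where
    n∸[b+1+d]≡u : n ∸ (suc b + d) ≡ u
    n∸[b+1+d]≡u = m+n∸m≡n (suc b + d) u
    n∸[b+1]≡u+d : n ∸ suc b ≡ u + d
    n∸[b+1]≡u+d =
      trans (cong (_∸ suc b) (+-assoc (suc b) d u)) (trans (m+n∸m≡n (suc b) (d + u)) (+-comm d u))
  InS⇒InS-n∸ {x} (inj₂ (lo , hi)) =
    inj₁ (subst (_≤ n ∸ x) n∸[u+d]≡b+1 (∸-monoʳ-≤ n hi) , subst (n ∸ x ≤_) n∸u≡b+1+d (∸-monoʳ-≤ n lo))
    where
    n∸[u+d]≡b+1 : n ∸ (u + d) ≡ suc b
    n∸[u+d]≡b+1 = trans (cong₂ _∸_ (+-assoc (suc b) d u) (+-comm u d)) (m+n∸n≡m (suc b) (d + u))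
    n∸u≡b+1+d : n ∸ u ≡ suc b + d
    n∸u≡b+1+d = m+n∸n≡m (suc b + d) u

  module _ (b+d≤u : suc b + d ≤ u) where

    b<u : b < u
    b<u = ≤-trans (m≤m+n (suc b) d) b+d≤u

    u<n : u < n
    u<n = s≤s (m≤n+m u (b + d))

    u+d<n : u + d < n
    u+d<n = s≤s (≤-trans (≤-reflexive (+-comm u d)) (+-monoˡ-≤ u (m≤n+m d b)))

    b+b<n : b + b < n
    b+b<n = ≤-trans (+-monoʳ-≤ (suc b) (<⇒≤ b<u)) (+-monoˡ-≤ u (m≤m+n (suc b) d))

    InS⇒<n : ∀ {x} → InS x → x < n
    InS⇒<n (inj₁ (_ , hi)) = ≤-<-trans hi (≤-<-trans b+d≤u u<n)
    InS⇒<n (inj₂ (_ , hi)) = ≤-<-trans hi u+d<n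

    above⇒<b : ∀ W → suc (u + d) + W < n → W < b
    above⇒<b W lt = +-cancelˡ-< (suc (u + d)) W b (subst (suc (u + d) + W <_) (n≡ b d u) lt)
      where
      n≡ : ∀ b d u → suc b + d + u ≡ suc (u + d) + b
      n≡ = solve-∀

    ∉S-below : ∀ {x} → x ≤ b → ¬ InS x
    ∉S-below x≤b (inj₁ (lo , _)) = <⇒≱ lo x≤b
    ∉S-below x≤b (inj₂ (lo , _)) = <⇒≱ (<-≤-trans b<u lo) x≤b

    ∉S-gap : ∀ {x} → suc b + d < x → x < u → ¬ InS x
    ∉S-gap b+d<x _   (inj₁ (_ , hi)) = <⇒≱ b+d<x hi
    ∉S-gap _   x<u (inj₂ (lo , _)) = <⇒≱ x<u lo

    ∉S-above : ∀ {x} → u + d < x → ¬ InS x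
    ∉S-above u+d<x (inj₁ (_ , hi)) = <⇒≱ u+d<x (≤-trans hi (≤-trans b+d≤u (m≤m+n u d)))
    ∉S-above u+d<x (inj₂ (_ , hi)) = <⇒≱ u+d<x hi

    -- N is within b of a multiple of n, so N mod n lies in [0, b] or above u + d.
    near-multiple⇒∉S : ∀ {N} Q R → b + N ≡ Q * n + R → R ≤ b + b → ¬ InS (N % n)
    near-multiple⇒∉S {N} Q R b+N≡ R≤b+b with b + N % n <? n
    ... | yes b+r<n = ∉S-below (+-cancelˡ-≤ b _ b (subst (_≤ b + b) (sym b+r≡R) R≤b+b))
      where
      open ≡-Reasoning
      b+r≡R : b + N % n ≡ R
      b+r≡R = begin
        b + N % n        ≡⟨ m<n⇒m%n≡m b+r<n ⟨
        (b + N % n) % n  ≡⟨ [m+n%o]%o≡[m+n]%o b N n ⟩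
        (b + N) % n      ≡⟨ cong (_% n) b+N≡ ⟩
        (Q * n + R) % n  ≡⟨ [kn+m]%n≡m Q (≤-<-trans R≤b+b b+b<n) ⟩
        R                ∎
    ... | no b+r≮n = ∉S-above (+-cancelˡ-≤ b _ _ (subst (_≤ b + N % n) (n≡ b d u) (≮⇒≥ b+r≮n)))
      where
      n≡ : ∀ b d u → suc b + d + u ≡ b + suc (u + d)
      n≡ = solve-∀

    in-gap⇒∉S : ∀ {N} Q R → N ≡ Q * n + R → suc b + d < R → R < u → ¬ InS (N % n)
    in-gap⇒∉S {N} Q R N≡ b+d<R R<u =
      subst (λ x → ¬ InS x) (sym N%n≡R) (∉S-gap b+d<R R<u)
      where
      N%n≡R : N % n ≡ R
      N%n≡R = trans (cong (_% n) N≡) ([kn+m]%n≡m Q (<-trans R<u u<n))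

    S-symmetric : Symmetric S
    S-symmetric x x∈S = subst InS (sym toℕ-⊖x) (InS⇒InS-n∸ x∈S)
      where
      toℕ-⊖x : toℕ (⊖ x) ≡ n ∸ toℕ x
      toℕ-⊖x = trans (toℕ-fromℕ< (m%n<n (n ∸ toℕ x) n)) (m<n⇒m%n≡m (InS⇒<n (InS⇒InS-n∸ x∈S)))

    member : ∀ {x} → InS x → ∃ λ (y : ℤ n) → S y × toℕ y ≡ x
    member {x} x∈S = fromℕ< (InS⇒<n x∈S) , subst InS (sym toℕ-y) x∈S , toℕ-y
      where
      toℕ-y : toℕ (fromℕ< (InS⇒<n x∈S)) ≡ x
      toℕ-y = toℕ-fromℕ< (InS⇒<n x∈S)

    members-with-sum : ∀ j k W → W ≤ (j + k) * d →
      ∃ λ (v : Vec (ℤ n) (j + k)) → All S v × sum (map toℕ v) ≡ j * suc b + k * u + W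
    members-with-sum zero zero W W≤0 = [] , [] , sym (n≤0⇒n≡0 W≤0)
    members-with-sum (suc j) k W W≤ with w , W′ , w≤d , W′≤ , refl ← ≤-suc-*-split (j + k) d W W≤
      with v , v⊆S , Σv≡ ← members-with-sum j k W′ W′≤
      with x , x∈S , x≡ ← member (inj₁ (m≤m+n (suc b) w , +-monoʳ-≤ (suc b) w≤d)) =
      x ∷ v , x∈S ∷ v⊆S , trans (cong₂ _+_ x≡ Σv≡) (shuffle (suc b) w j k u W′)
      where
      shuffle : ∀ a w j k u W → a + w + (j * a + k * u + W) ≡ suc j * a + k * u + (w + W)
      shuffle = solve-∀
    members-with-sum zero (suc k) W W≤ with w , W′ , w≤d , W′≤ , refl ← ≤-suc-*-split k d W W≤
      with v , v⊆S , Σv≡ ← members-with-sum zero k W′ W′≤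
      with x , x∈S , x≡ ← member (inj₂ (m≤m+n u w , +-monoʳ-≤ u w≤d)) =
      x ∷ v , x∈S ∷ v⊆S , trans (cong₂ _+_ x≡ Σv≡) (shuffle w k u W′)
      where
      shuffle : ∀ w k u W → u + w + (k * u + W) ≡ suc k * u + (w + W)
      shuffle = solve-∀

    sum-free : ∀ ℓ → (∀ j k W → j + k ≡ ℓ → W ≤ ℓ * d → ¬ InS ((j * suc b + k * u + W) % n)) →
      SumFree ℓ S
    sum-free ℓ sums-∉S x (v , v⊆S , Σv≡x) x∈S with j , k , W , j+k≡ℓ , W≤ , Σv≡ ← sum-of-members v v⊆S =
      sums-∉S j k W j+k≡ℓ W≤ (subst InS toℕ-x x∈S)
      where
      open ≡-Reasoning
      toℕ-x : toℕ x ≡ (j * suc b + k * u + W) % n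
      toℕ-x = begin
        toℕ x                      ≡⟨ cong toℕ Σv≡x ⟨
        toℕ (sumℤ v)               ≡⟨ toℕ-sumℤ v ⟩
        sum (map toℕ v) % n        ≡⟨ cong (_% n) Σv≡ ⟩
        (j * suc b + k * u + W) % n ∎

    complete : ∀ ℓ → (∀ X → X < n → InS X ⊎ SumRep ℓ X) → ∀ x → sumset ℓ S x ⊎ S x
    complete ℓ cover x with cover (toℕ x) (toℕ<n x)
    ... | inj₁ x∈S = inj₂ x∈S
    ... | inj₂ (j , k , W , Q , refl , W≤ , ≡Qn+x) with v , v⊆S , Σv≡ ← members-with-sum j k W W≤ =
      inj₁ (v , v⊆S , toℕ-injective toℕ-Σv)
      where
      open ≡-Reasoning
      toℕ-Σv : toℕ (sumℤ v) ≡ toℕ x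
      toℕ-Σv = begin
        toℕ (sumℤ v)                ≡⟨ toℕ-sumℤ v ⟩
        sum (map toℕ v) % n         ≡⟨ cong (_% n) (trans Σv≡ ≡Qn+x) ⟩
        (Q * n + toℕ x) % n         ≡⟨ [kn+m]%n≡m Q (toℕ<n x) ⟩
        toℕ x                       ∎

    module _ (ℓ γ : ℕ) (γ≤ : γ ≤ ℓ * d) where

      gap-cover : (∀ Y → Y ≤ ℓ * d → SumRep ℓ (suc (suc b + d) + Y)) →
        (∀ W → suc (suc b + d) + (γ + W) < u → SumRep ℓ (suc (suc b + d) + (γ + W))) →
        ∀ X → suc b + d < X → X < u → SumRep ℓ X
      gap-cover low high X b+d<X X<u with Y , refl ← m≤n⇒∃[o]m+o≡n b+d<X with Y ≤? ℓ * d
      ... | yes Y≤ = low Y Y≤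
      ... | no  Y≰ with W , refl ← m≤n⇒∃[o]m+o≡n (≤-trans γ≤ (<⇒≤ (≰⇒> Y≰))) = high W X<u

      cover-by-regions : (∀ X → X ≤ b → SumRep ℓ X) →
        (∀ Y → Y ≤ ℓ * d → SumRep ℓ (suc (suc b + d) + Y)) →
        (∀ W → suc (suc b + d) + (γ + W) < u → SumRep ℓ (suc (suc b + d) + (γ + W))) →
        (∀ W → suc (u + d) + W < n → SumRep ℓ (suc (u + d) + W)) →
        ∀ X → X < n → InS X ⊎ SumRep ℓ X
      cover-by-regions below low high above X X<n with X ≤? b | X ≤? suc b + d | X <? u | X ≤? u + d
      ... | yes X≤b | _         | _       | _         = inj₂ (below X X≤b)
      ... | no  X≰b | yes X≤b+d | _       | _         = inj₁ (inj₁ (≰⇒> X≰b , X≤b+d))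
      ... | no  _   | no  X≰b+d | yes X<u | _         = inj₂ (gap-cover low high X (≰⇒> X≰b+d) X<u)
      ... | no  _   | no  _     | no  X≮u | yes X≤u+d = inj₁ (inj₂ (≮⇒≥ X≮u , X≤u+d))
      ... | no  _   | no  _     | no  _   | no  X≰u+d with W , refl ← m≤n⇒∃[o]m+o≡n (≰⇒> X≰u+d) =
        inj₂ (above W X<n)

-- Sorted by the sign of j − k and by |j − k| being 4r or 4r + 2; the indices are chosen
-- so that shifting (j, k) by (2, 2) is definitional.
data SplitOf4K : ℕ → ℕ → ℕ → Set where
  even-left  : ∀ t r → SplitOf4K (t + r) (t * 2 + r * 4) (t * 2)
  odd-left   : ∀ t r → SplitOf4K (suc (t + r)) (t * 2 + r * 4 + 3) (suc (t * 2))
  even-right : ∀ t r → SplitOf4K (t + r) (t * 2) (t * 2 + r * 4)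
  odd-right  : ∀ t r → SplitOf4K (suc (t + r)) (suc (t * 2)) (t * 2 + r * 4 + 3)

data SplitOf4K+2 : ℕ → ℕ → ℕ → Set where
  odd-left   : ∀ t r → SplitOf4K+2 (t + r) (suc (t * 2 + r * 4)) (suc (t * 2))
  even-left  : ∀ t r → SplitOf4K+2 (t + r) (t * 2 + r * 4 + 2) (t * 2)
  odd-right  : ∀ t r → SplitOf4K+2 (t + r) (suc (t * 2)) (suc (t * 2 + r * 4))
  even-right : ∀ t r → SplitOf4K+2 (t + r) (t * 2) (t * 2 + r * 4 + 2)

shift-4K : ∀ {K j k} → SplitOf4K K j k → SplitOf4K (suc K) (2 + j) (2 + k)
shift-4K (even-left t r)  = even-left (suc t) r
shift-4K (odd-left t r)   = odd-left (suc t) r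
shift-4K (even-right t r) = even-right (suc t) r
shift-4K (odd-right t r)  = odd-right (suc t) r

shift-4K+2 : ∀ {K j k} → SplitOf4K+2 K j k → SplitOf4K+2 (suc K) (2 + j) (2 + k)
shift-4K+2 (odd-left t r)   = odd-left (suc t) r
shift-4K+2 (even-left t r)  = even-left (suc t) r
shift-4K+2 (odd-right t r)  = odd-right (suc t) r
shift-4K+2 (even-right t r) = even-right (suc t) r

2+j+[2+k]≡4+m⇒j+k≡m : ∀ j k m → 2 + j + (2 + k) ≡ 4 + m → j + k ≡ m
2+j+[2+k]≡4+m⇒j+k≡m j k m eq = +-cancelˡ-≡ 4 (j + k) m (trans (regroup j k) eq)
  where
  regroup : ∀ j k → 4 + (j + k) ≡ 2 + j + (2 + k)
  regroup = solve-∀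

split-4K : ∀ K j k → j + k ≡ K * 4 → SplitOf4K K j k
split-4K K       zero          k             refl = even-right 0 K
split-4K zero    (suc j)       k             ()
split-4K (suc K) (suc zero)    k             eq
  with refl ← trans (suc-injective eq) (+-comm 3 (K * 4)) = odd-right 0 K
split-4K (suc K) (suc (suc j)) zero          eq =
  subst (λ j → SplitOf4K (suc K) j 0) (trans (sym eq) (+-identityʳ _)) (even-left 0 (suc K))
split-4K (suc K) (suc (suc j)) (suc zero)    eq =
  subst (λ j → SplitOf4K (suc K) j 1)
    (+-cancelʳ-≡ 1 _ _ (trans (trans (+-assoc (K * 4) 3 1) (+-comm (K * 4) 4)) (sym eq))) (odd-left 0 K)
split-4K (suc K) (suc (suc j)) (suc (suc k)) eq =
  shift-4K (split-4K K j k (2+j+[2+k]≡4+m⇒j+k≡m j k (K * 4) eq))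

split-4K+2 : ∀ K j k → j + k ≡ K * 4 + 2 → SplitOf4K+2 K j k
split-4K+2 K       zero          k             refl = even-right 0 K
split-4K+2 K       (suc zero)    k             eq
  with refl ← trans (suc-injective (trans eq (+-suc (K * 4) 1))) (+-comm (K * 4) 1) = odd-right 0 K
split-4K+2 K       (suc (suc j)) zero          eq =
  subst (λ j → SplitOf4K+2 K j 0) (trans (sym eq) (+-identityʳ _)) (even-left 0 K)
split-4K+2 K       (suc (suc j)) (suc zero)    eq =
  subst (λ j → SplitOf4K+2 K j 1)
    (+-cancelʳ-≡ 1 _ _ (trans (sym (+-suc (K * 4) 1)) (sym eq))) (odd-left 0 K)
split-4K+2 zero    (suc (suc j)) (suc (suc k)) eq =
  contradiction (m+n≡0⇒n≡0 j (suc-injective (suc-injective eq))) λ ()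
split-4K+2 (suc K) (suc (suc j)) (suc (suc k)) eq =
  shift-4K+2 (split-4K+2 K j k (2+j+[2+k]≡4+m⇒j+k≡m j k (K * 4 + 2) eq))

-- ℓ = 4K

b₀ u₀ : ℕ → ℕ → ℕ → ℕ
b₀ K e f = 2 * K * e + 3 * K * f
u₀ K e f = (6 * K + 1) * e + 3 + 9 * K * f

module Intervals₀ (K e f : ℕ) = TwoIntervals (b₀ K e f) (e + f) (u₀ K e f)

gap₀ : ∀ κ e f → suc (b₀ (suc κ) e f) + (e + f) ≤ u₀ (suc κ) e f
gap₀ κ e f = m+n≡o⇒m≤o _ (u≡ κ e f)
  where
  u≡ : ∀ κ e f → let K = suc κ ; b = 2 * K * e + 3 * K * f in
    suc b + (e + f) + (4 * K * e + 2 + (6 * κ + 5) * f) ≡ (6 * K + 1) * e + 3 + 9 * K * f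
  u≡ = solve-∀

sums-∉S₀ : ∀ K e f → suc (b₀ K e f) + (e + f) ≤ u₀ K e f →
  ∀ j k W → j + k ≡ K * 4 → W ≤ K * 4 * (e + f) →
  ¬ Intervals₀.InS K e f ((j * suc (b₀ K e f) + k * u₀ K e f + W) % Intervals₀.n K e f)
sums-∉S₀ K e f gap j k W j+k≡ W≤ with split-4K K j k j+k≡
... | even-left t r =
  near-multiple⇒∉S gap (t * 2 + r) ((t + r * 2) * f + W) (sum≡ t r e f W)
    (+-monoʳ-≤-within _ W≤ (slack≡ t r e f))
  where
  open Intervals₀ (t + r) e f
  sum≡ : ∀ t r e f W →
    let K = t + r ; b = 2 * K * e + 3 * K * f ; u = (6 * K + 1) * e + 3 + 9 * K * f in
    b + ((t * 2 + r * 4) * suc b + t * 2 * u + W)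
      ≡ (t * 2 + r) * (suc b + (e + f) + u) + ((t + r * 2) * f + W)
  sum≡ = solve-∀
  slack≡ : ∀ t r e f → let K = t + r ; b = 2 * K * e + 3 * K * f in
    (t + r * 2) * f + K * 4 * (e + f) + t * f ≡ b + b
  slack≡ = solve-∀
... | odd-left t r =
  in-gap⇒∉S gap (t * 2 + r + 1) (P + W) (sum≡ t r e f W) (m<1+m+n+o _ s′ W)
    (+-monoʳ-≤-within (suc P) W≤ (slack≡ t r e f))
  where
  open Intervals₀ (suc (t + r)) e f
  s′ P : ℕ
  s′ = (suc (t + r) + r) * f
  P = suc (suc (b₀ (suc (t + r)) e f) + (e + f)) + s′
  sum≡ : ∀ t r e f W →
    let K = suc (t + r) ; b = 2 * K * e + 3 * K * f ; u = (6 * K + 1) * e + 3 + 9 * K * f in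
    (t * 2 + r * 4 + 3) * suc b + suc (t * 2) * u + W ≡
    (t * 2 + r + 1) * (suc b + (e + f) + u) + (suc (suc b + (e + f)) + (K + r) * f + W)
  sum≡ = solve-∀
  slack≡ : ∀ t r e f → let K = suc (t + r) ; b = 2 * K * e + 3 * K * f in
    suc (suc (suc b + (e + f)) + (K + r) * f) + K * 4 * (e + f) + t * f
      ≡ (6 * K + 1) * e + 3 + 9 * K * f
  slack≡ = solve-∀
... | even-right t r =
  near-multiple⇒∉S gap (t * 2 + r * 3) (t * f + W) (sum≡ t r e f W)
    (+-monoʳ-≤-within _ W≤ (slack≡ t r e f))
  where
  open Intervals₀ (t + r) e f
  sum≡ : ∀ t r e f W →
    let K = t + r ; b = 2 * K * e + 3 * K * f ; u = (6 * K + 1) * e + 3 + 9 * K * f in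
    b + (t * 2 * suc b + (t * 2 + r * 4) * u + W)
      ≡ (t * 2 + r * 3) * (suc b + (e + f) + u) + (t * f + W)
  sum≡ = solve-∀
  slack≡ : ∀ t r e f → let K = t + r ; b = 2 * K * e + 3 * K * f in
    t * f + K * 4 * (e + f) + (t + r * 2) * f ≡ b + b
  slack≡ = solve-∀
... | odd-right t r =
  in-gap⇒∉S gap (t * 2 + r * 3 + 2) (P + W) (sum≡ t r e f W) (m<1+m+n+o _ s′ W)
    (+-monoʳ-≤-within (suc P) W≤ (slack≡ t r e f))
  where
  open Intervals₀ (suc (t + r)) e f
  s′ P : ℕ
  s′ = t * f
  P = suc (suc (b₀ (suc (t + r)) e f) + (e + f)) + s′
  sum≡ : ∀ t r e f W →
    let K = suc (t + r) ; b = 2 * K * e + 3 * K * f ; u = (6 * K + 1) * e + 3 + 9 * K * f in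
    suc (t * 2) * suc b + (t * 2 + r * 4 + 3) * u + W ≡
    (t * 2 + r * 3 + 2) * (suc b + (e + f) + u) + (suc (suc b + (e + f)) + t * f + W)
  sum≡ = solve-∀
  slack≡ : ∀ t r e f → let K = suc (t + r) ; b = 2 * K * e + 3 * K * f in
    suc (suc (suc b + (e + f)) + t * f) + K * 4 * (e + f) + (t + r * 2 + 1) * f
      ≡ (6 * K + 1) * e + 3 + 9 * K * f
  slack≡ = solve-∀

module Construction₀ (κ e f : ℕ) where
  open Intervals₀ (suc κ) e f

  ℓ γ : ℕ
  ℓ = suc κ * 4
  γ = (κ * 2 + 1) * f

  b+c≡L : ∀ κ e f →
    let K = suc κ ; b = 2 * K * e + 3 * K * f in b + K * (2 * e + f) ≡ K * 4 * (e + f)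
  b+c≡L = solve-∀

  γ≤L : γ ≤ ℓ * (e + f)
  γ≤L = m+n≡o⇒m≤o γ (γ+c≡L κ e f)
    where
    γ+c≡L : ∀ κ e f → (κ * 2 + 1) * f + (suc κ * 4 * e + (κ * 2 + 3) * f) ≡ suc κ * 4 * (e + f)
    γ+c≡L = solve-∀

  sums-below : ∀ X → X ≤ b₀ (suc κ) e f → SumRep ℓ X
  sums-below X X≤b = ℓ , 0 , X + suc κ * (2 * e + f) , suc κ , +-identityʳ ℓ ,
    ≤-trans (+-monoˡ-≤ _ X≤b) (≤-reflexive (b+c≡L κ e f)) , sum≡ κ e f X
    where
    sum≡ : ∀ κ e f X →
      let K = suc κ ; b = 2 * K * e + 3 * K * f ; u = (6 * K + 1) * e + 3 + 9 * K * f in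
      K * 4 * suc b + 0 * u + (X + K * (2 * e + f)) ≡ K * (suc b + (e + f) + u) + X
    sum≡ = solve-∀

  sums-low-gap : ∀ Y → Y ≤ ℓ * (e + f) → SumRep ℓ (suc (suc (b₀ (suc κ) e f) + (e + f)) + Y)
  sums-low-gap Y Y≤ = 1 , 3 + κ * 4 , Y , κ * 3 + 2 , refl , Y≤ , sum≡ κ e f Y
    where
    sum≡ : ∀ κ e f Y →
      let K = suc κ ; b = 2 * K * e + 3 * K * f ; u = (6 * K + 1) * e + 3 + 9 * K * f in
      1 * suc b + (3 + κ * 4) * u + Y
        ≡ (κ * 3 + 2) * (suc b + (e + f) + u) + (suc (suc b + (e + f)) + Y)
    sum≡ = solve-∀

  sums-high-gap : ∀ W → suc (suc (b₀ (suc κ) e f) + (e + f)) + (γ + W) < u₀ (suc κ) e f →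
    SumRep ℓ (suc (suc (b₀ (suc κ) e f) + (e + f)) + (γ + W))
  sums-high-gap W lt = 3 + κ * 4 , 1 , W , suc κ , +-comm (3 + κ * 4) 1 ,
    +-cancelˡ-≤ γ W _ (+-cancelˡ-≤ x _ _ (≤-pred (subst (x + (γ + W) <_) (u≡ κ e f) lt))) , sum≡ κ e f W
    where
    x : ℕ
    x = suc (suc (b₀ (suc κ) e f) + (e + f))
    u≡ : ∀ κ e f → let K = suc κ ; b = 2 * K * e + 3 * K * f in
      (6 * K + 1) * e + 3 + 9 * K * f
        ≡ suc (suc (suc b + (e + f)) + ((κ * 2 + 1) * f + K * 4 * (e + f)))
    u≡ = solve-∀
    sum≡ : ∀ κ e f W →
      let K = suc κ ; b = 2 * K * e + 3 * K * f ; u = (6 * K + 1) * e + 3 + 9 * K * f in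
      (3 + κ * 4) * suc b + 1 * u + W
        ≡ K * (suc b + (e + f) + u) + (suc (suc b + (e + f)) + ((κ * 2 + 1) * f + W))
    sum≡ = solve-∀

  sums-above : ∀ W → suc (u₀ (suc κ) e f + (e + f)) + W < n →
    SumRep ℓ (suc (u₀ (suc κ) e f + (e + f)) + W)
  sums-above W lt = 0 , ℓ , W , κ * 3 + 2 , refl ,
    ≤-trans (<⇒≤ (above⇒<b (gap₀ κ e f) W lt)) (m+n≡o⇒m≤o _ (b+c≡L κ e f)) , sum≡ κ e f W
    where
    sum≡ : ∀ κ e f W →
      let K = suc κ ; b = 2 * K * e + 3 * K * f ; u = (6 * K + 1) * e + 3 + 9 * K * f in
      0 * suc b + K * 4 * u + W ≡ (κ * 3 + 2) * (suc b + (e + f) + u) + (suc (u + (e + f)) + W)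
    sum≡ = solve-∀

  complete-sum-free : ∃ λ (S′ : SubsetOf n) → Symmetric S′ × CompleteSumFree ℓ S′
  complete-sum-free = S , S-symmetric gap , sum-free gap ℓ (sums-∉S₀ (suc κ) e f gap) ,
    complete gap ℓ (cover-by-regions gap ℓ γ γ≤L sums-below sums-low-gap sums-high-gap sums-above)
    where
    gap : suc (b₀ (suc κ) e f) + (e + f) ≤ u₀ (suc κ) e f
    gap = gap₀ κ e f

parameters₀ : ∀ κ n → 12 * (suc κ * 4) * (suc κ * 4) + 36 * (suc κ * 4) + 24 < n →
  ∃₂ λ e f → n ≡ Intervals₀.n (suc κ) e f
parameters₀ κ n bound =
  let e , f , n≡ = a+[M+α]*M<n⇒n≡a+M*e+[M+α]*f (suc κ * 8 + 2) (κ * 4 + 3) {c = κ * 3 + 2} 4 n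
                     (inverse κ) (≤-<-trans (m+n≡o⇒m≤o _ (slack κ)) bound)
  in e , f , trans n≡ (regroup κ e f)
  where
  inverse : ∀ κ → (κ * 4 + 3) * (κ * 6 + 7) ≡ 1 + (suc κ * 8 + 2) * (κ * 3 + 2)
  inverse = solve-∀
  slack : ∀ κ → 4 + (suc κ * 8 + 2 + (κ * 4 + 3)) * (suc κ * 8 + 2) + (96 * κ * κ + 304 * κ + 226)
              ≡ 12 * (suc κ * 4) * (suc κ * 4) + 36 * (suc κ * 4) + 24
  slack = solve-∀
  regroup : ∀ κ e f →
    let K = suc κ ; b = 2 * K * e + 3 * K * f ; u = (6 * K + 1) * e + 3 + 9 * K * f in
    4 + ((suc κ * 8 + 2) * e + (suc κ * 8 + 2 + (κ * 4 + 3)) * f) ≡ suc b + (e + f) + u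
  regroup = solve-∀

complete-sum-free₀ : ∀ κ {n} .{{_ : NonZero n}} → (∃₂ λ e f → n ≡ Intervals₀.n (suc κ) e f) →
  ∃ λ (S : SubsetOf n) → Symmetric S × CompleteSumFree (suc κ * 4) S
complete-sum-free₀ κ (e , f , refl) = Construction₀.complete-sum-free κ e f

-- ℓ = 4K + 2

b₂ u₂ : ℕ → ℕ → ℕ → ℕ
b₂ K e f = (2 * K + 1) * e + (3 * K + 1) * f
u₂ K e f = (6 * K + 4) * e + 3 + (9 * K + 5) * f

module Intervals₂ (K e f : ℕ) = TwoIntervals (b₂ K e f) (e + f) (u₂ K e f)

gap₂ : ∀ K e f → suc (b₂ K e f) + (e + f) ≤ u₂ K e f
gap₂ K e f = m+n≡o⇒m≤o _ (u≡ K e f)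
  where
  u≡ : ∀ K e f → let b = (2 * K + 1) * e + (3 * K + 1) * f in
    suc b + (e + f) + ((4 * K + 2) * e + 2 + (6 * K + 3) * f)
      ≡ (6 * K + 4) * e + 3 + (9 * K + 5) * f
  u≡ = solve-∀

sums-∉S₂ : ∀ K e f j k W → j + k ≡ K * 4 + 2 → W ≤ (K * 4 + 2) * (e + f) →
  ¬ Intervals₂.InS K e f ((j * suc (b₂ K e f) + k * u₂ K e f + W) % Intervals₂.n K e f)
sums-∉S₂ K e f j k W j+k≡ W≤ with split-4K+2 K j k j+k≡
... | odd-left t r =
  near-multiple⇒∉S (gap₂ (t + r) e f) (t * 2 + r + 1) (t * f + W) (sum≡ t r e f W)
    (+-monoʳ-≤-within _ W≤ (slack≡ t r e f))
  where
  open Intervals₂ (t + r) e f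
  sum≡ : ∀ t r e f W →
    let K = t + r ; b = (2 * K + 1) * e + (3 * K + 1) * f ; u = (6 * K + 4) * e + 3 + (9 * K + 5) * f in
    b + (suc (t * 2 + r * 4) * suc b + suc (t * 2) * u + W)
      ≡ (t * 2 + r + 1) * (suc b + (e + f) + u) + (t * f + W)
  sum≡ = solve-∀
  slack≡ : ∀ t r e f → let K = t + r ; b = (2 * K + 1) * e + (3 * K + 1) * f in
    t * f + (K * 4 + 2) * (e + f) + (t + r * 2) * f ≡ b + b
  slack≡ = solve-∀
... | even-left t r =
  in-gap⇒∉S (gap₂ (t + r) e f) (t * 2 + r) (P + W) (sum≡ t r e f W) (m<1+m+n+o _ s′ W)
    (+-monoʳ-≤-within (suc P) W≤ (slack≡ t r e f))
  where
  open Intervals₂ (t + r) e f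
  s′ P : ℕ
  s′ = t * f
  P = suc (suc (b₂ (t + r) e f) + (e + f)) + s′
  sum≡ : ∀ t r e f W →
    let K = t + r ; b = (2 * K + 1) * e + (3 * K + 1) * f ; u = (6 * K + 4) * e + 3 + (9 * K + 5) * f in
    (t * 2 + r * 4 + 2) * suc b + t * 2 * u + W ≡
    (t * 2 + r) * (suc b + (e + f) + u) + (suc (suc b + (e + f)) + t * f + W)
  sum≡ = solve-∀
  slack≡ : ∀ t r e f → let K = t + r ; b = (2 * K + 1) * e + (3 * K + 1) * f in
    suc (suc (suc b + (e + f)) + t * f) + (K * 4 + 2) * (e + f) + (t + r * 2 + 1) * f
      ≡ (6 * K + 4) * e + 3 + (9 * K + 5) * f
  slack≡ = solve-∀
... | odd-right t r =
  near-multiple⇒∉S (gap₂ (t + r) e f) (t * 2 + r * 3 + 1) ((t + r * 2) * f + W) (sum≡ t r e f W)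
    (+-monoʳ-≤-within _ W≤ (slack≡ t r e f))
  where
  open Intervals₂ (t + r) e f
  sum≡ : ∀ t r e f W →
    let K = t + r ; b = (2 * K + 1) * e + (3 * K + 1) * f ; u = (6 * K + 4) * e + 3 + (9 * K + 5) * f in
    b + (suc (t * 2) * suc b + suc (t * 2 + r * 4) * u + W)
      ≡ (t * 2 + r * 3 + 1) * (suc b + (e + f) + u) + ((t + r * 2) * f + W)
  sum≡ = solve-∀
  slack≡ : ∀ t r e f → let K = t + r ; b = (2 * K + 1) * e + (3 * K + 1) * f in
    (t + r * 2) * f + (K * 4 + 2) * (e + f) + t * f ≡ b + b
  slack≡ = solve-∀
... | even-right t r =
  in-gap⇒∉S (gap₂ (t + r) e f) (t * 2 + r * 3 + 1) (P + W) (sum≡ t r e f W) (m<1+m+n+o _ s′ W)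
    (+-monoʳ-≤-within (suc P) W≤ (slack≡ t r e f))
  where
  open Intervals₂ (t + r) e f
  s′ P : ℕ
  s′ = (t + r * 2 + 1) * f
  P = suc (suc (b₂ (t + r) e f) + (e + f)) + s′
  sum≡ : ∀ t r e f W →
    let K = t + r ; b = (2 * K + 1) * e + (3 * K + 1) * f ; u = (6 * K + 4) * e + 3 + (9 * K + 5) * f in
    t * 2 * suc b + (t * 2 + r * 4 + 2) * u + W ≡
    (t * 2 + r * 3 + 1) * (suc b + (e + f) + u) + (suc (suc b + (e + f)) + (t + r * 2 + 1) * f + W)
  sum≡ = solve-∀
  slack≡ : ∀ t r e f → let K = t + r ; b = (2 * K + 1) * e + (3 * K + 1) * f in
    suc (suc (suc b + (e + f)) + (t + r * 2 + 1) * f) + (K * 4 + 2) * (e + f) + t * f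
      ≡ (6 * K + 4) * e + 3 + (9 * K + 5) * f
  slack≡ = solve-∀

module Construction₂ (K e f : ℕ) where
  open Intervals₂ K e f

  ℓ γ : ℕ
  ℓ = K * 4 + 2
  γ = (K * 2 + 1) * f

  b+c≡L : ∀ K e f → let b = (2 * K + 1) * e + (3 * K + 1) * f in
    b + ((2 * K + 1) * e + (K + 1) * f) ≡ (K * 4 + 2) * (e + f)
  b+c≡L = solve-∀

  γ≤L : γ ≤ ℓ * (e + f)
  γ≤L = m+n≡o⇒m≤o γ (γ+c≡L K e f)
    where
    γ+c≡L : ∀ K e f → (K * 2 + 1) * f + ((K * 4 + 2) * e + (K * 2 + 1) * f) ≡ (K * 4 + 2) * (e + f)
    γ+c≡L = solve-∀

  sums-below : ∀ X → X ≤ b₂ K e f → SumRep ℓ X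
  sums-below X X≤b =
    1 , K * 4 + 1 , X + ((2 * K + 1) * e + (K + 1) * f) , K * 3 + 1 , sym (+-suc (K * 4) 1) ,
    ≤-trans (+-monoˡ-≤ _ X≤b) (≤-reflexive (b+c≡L K e f)) , sum≡ K e f X
    where
    sum≡ : ∀ K e f X →
      let b = (2 * K + 1) * e + (3 * K + 1) * f ; u = (6 * K + 4) * e + 3 + (9 * K + 5) * f in
      1 * suc b + (K * 4 + 1) * u + (X + ((2 * K + 1) * e + (K + 1) * f))
        ≡ (K * 3 + 1) * (suc b + (e + f) + u) + X
    sum≡ = solve-∀

  sums-low-gap : ∀ Y → Y ≤ ℓ * (e + f) → SumRep ℓ (suc (suc (b₂ K e f) + (e + f)) + Y)
  sums-low-gap Y Y≤ = ℓ , 0 , Y , K , +-identityʳ ℓ , Y≤ , sum≡ K e f Y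
    where
    sum≡ : ∀ K e f Y →
      let b = (2 * K + 1) * e + (3 * K + 1) * f ; u = (6 * K + 4) * e + 3 + (9 * K + 5) * f in
      (K * 4 + 2) * suc b + 0 * u + Y ≡ K * (suc b + (e + f) + u) + (suc (suc b + (e + f)) + Y)
    sum≡ = solve-∀

  sums-high-gap : ∀ W → suc (suc (b₂ K e f) + (e + f)) + (γ + W) < u₂ K e f →
    SumRep ℓ (suc (suc (b₂ K e f) + (e + f)) + (γ + W))
  sums-high-gap W lt = 0 , ℓ , W , K * 3 + 1 , refl ,
    +-cancelˡ-≤ γ W _ (+-cancelˡ-≤ x _ _ (≤-pred (subst (x + (γ + W) <_) (u≡ K e f) lt))) , sum≡ K e f W
    where
    x : ℕ
    x = suc (suc (b₂ K e f) + (e + f))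
    u≡ : ∀ K e f → let b = (2 * K + 1) * e + (3 * K + 1) * f in
      (6 * K + 4) * e + 3 + (9 * K + 5) * f
        ≡ suc (suc (suc b + (e + f)) + ((K * 2 + 1) * f + (K * 4 + 2) * (e + f)))
    u≡ = solve-∀
    sum≡ : ∀ K e f W →
      let b = (2 * K + 1) * e + (3 * K + 1) * f ; u = (6 * K + 4) * e + 3 + (9 * K + 5) * f in
      0 * suc b + (K * 4 + 2) * u + W
        ≡ (K * 3 + 1) * (suc b + (e + f) + u) + (suc (suc b + (e + f)) + ((K * 2 + 1) * f + W))
    sum≡ = solve-∀

  sums-above : ∀ W → suc (u₂ K e f + (e + f)) + W < n →
    SumRep ℓ (suc (u₂ K e f + (e + f)) + W)
  sums-above W lt = K * 4 + 1 , 1 , W , K , +-assoc (K * 4) 1 1 ,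
    ≤-trans (<⇒≤ (above⇒<b (gap₂ K e f) W lt)) (m+n≡o⇒m≤o _ (b+c≡L K e f)) , sum≡ K e f W
    where
    sum≡ : ∀ K e f W →
      let b = (2 * K + 1) * e + (3 * K + 1) * f ; u = (6 * K + 4) * e + 3 + (9 * K + 5) * f in
      (K * 4 + 1) * suc b + 1 * u + W ≡ K * (suc b + (e + f) + u) + (suc (u + (e + f)) + W)
    sum≡ = solve-∀

  complete-sum-free : ∃ λ (S′ : SubsetOf n) → Symmetric S′ × CompleteSumFree ℓ S′
  complete-sum-free = S , S-symmetric gap , sum-free gap ℓ (sums-∉S₂ K e f) ,
    complete gap ℓ (cover-by-regions gap ℓ γ γ≤L sums-below sums-low-gap sums-high-gap sums-above)
    where
    gap : suc (b₂ K e f) + (e + f) ≤ u₂ K e f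
    gap = gap₂ K e f

parameters₂ : ∀ K n → 12 * (K * 4 + 2) * (K * 4 + 2) + 36 * (K * 4 + 2) + 24 < n →
  ∃₂ λ e f → n ≡ Intervals₂.n K e f
parameters₂ K n bound =
  let e , f , n≡ = a+[M+α]*M<n⇒n≡a+M*e+[M+α]*f (6 + K * 8) (K * 4 + 1) {c = K} 4 n
                     (inverse K) (≤-<-trans (m+n≡o⇒m≤o _ (slack K)) bound)
  in e , f , trans n≡ (regroup K e f)
  where
  inverse : ∀ K → (K * 4 + 1) * (K * 2 + 1) ≡ 1 + (6 + K * 8) * K
  inverse = solve-∀
  slack : ∀ K → 4 + (6 + K * 8 + (K * 4 + 1)) * (6 + K * 8) + (96 * K * K + 208 * K + 98)
              ≡ 12 * (K * 4 + 2) * (K * 4 + 2) + 36 * (K * 4 + 2) + 24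
  slack = solve-∀
  regroup : ∀ K e f →
    let b = (2 * K + 1) * e + (3 * K + 1) * f ; u = (6 * K + 4) * e + 3 + (9 * K + 5) * f in
    4 + ((6 + K * 8) * e + (6 + K * 8 + (K * 4 + 1)) * f) ≡ suc b + (e + f) + u
  regroup = solve-∀

complete-sum-free₂ : ∀ K {n} .{{_ : NonZero n}} → (∃₂ λ e f → n ≡ Intervals₂.n K e f) →
  ∃ λ (S : SubsetOf n) → Symmetric S × CompleteSumFree (K * 4 + 2) S
complete-sum-free₂ K (e , f , refl) = Construction₂.complete-sum-free K e f

even⇒≡4K⊎≡4K+2 : ∀ {ℓ} → 2 ∣ ℓ → (∃ λ K → ℓ ≡ K * 4) ⊎ (∃ λ K → ℓ ≡ K * 4 + 2)
even⇒≡4K⊎≡4K+2 (divides-refl h) = double h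
  where
  double : ∀ h → (∃ λ K → h * 2 ≡ K * 4) ⊎ (∃ λ K → h * 2 ≡ K * 4 + 2)
  double zero          = inj₁ (0 , refl)
  double (suc zero)    = inj₂ (0 , refl)
  double (suc (suc h)) with double h
  ... | inj₁ (K , eq) = inj₁ (suc K , cong (4 +_) eq)
  ... | inj₂ (K , eq) = inj₂ (suc K , cong (4 +_) eq)

corollary1p4 : (ℓ : ℕ) → 2 ∣ ℓ → 4 ≤ ℓ → (n : ℕ) .{{_ : NonZero n}} →
    12 * ℓ * ℓ + 36 * ℓ + 24 < n →
    ∃ λ (S : SubsetOf n) → Symmetric S × CompleteSumFree ℓ S
corollary1p4 ℓ 2∣ℓ 4≤ℓ n bound with even⇒≡4K⊎≡4K+2 2∣ℓ
... | inj₁ (zero , refl)  = contradiction 4≤ℓ λ ()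
... | inj₁ (suc κ , refl) = complete-sum-free₀ κ (parameters₀ κ n bound)
... | inj₂ (K , refl)     = complete-sum-free₂ K (parameters₂ K n bound)
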